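{- For all integers $k\ge 3$ and $m\ge 1$ there are mutually disjoint combinatorial lines $L_1, \dots, L_m\subseteq [k]^{2m}$ such that the only quasilines $L\subseteq L_1\cup\dots\cup L_m$ are $L_1, \dots, L_m$ themselves.
   Context: A combinatorial line in $[k]^N$ is the image of a map $\eta\colon[k]\to[k]^N$ for which there is a partition $[N]=C\cup M$ with $M\neq\emptyset$ such that, writing $\eta(i)=(u_{i1},\dots,u_{iN})$, we have $u_{1c}=\dots=u_{kc}$ for $c\in C$ and $u_{im}=i$ for $i\in[k]$, $m\in M$. A quasiline in $[k]^N$ is a $k$-element subset such that for every coordinate the entries of its points in that coordinate are either all identical or mutually distinct. -}

module Defs where

open import Data.Nat using (ℕ)
open import Data.Fin using (Fin)
open import Data.Bool using (Bool; true; false)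
open import Data.Product using (Σ; ∃; _×_; _,_)
open import Data.Sum using (_⊎_)
open import Relation.Binary.PropositionalEquality using (_≡_; _≢_)
open import Relation.Nullary using (¬_)

Point : ℕ → ℕ → Set
Point k N = Fin N → Fin k

_≈ₚ_ : ∀ {k N} → Point k N → Point k N → Set
x ≈ₚ y = ∀ c → x c ≡ y c

PointMap : ℕ → ℕ → Set
PointMap k N = Fin k → Point k N

-- η is a combinatorial line map: there is a partition [N] = C ∪ M
-- (M given by its indicator, true = in M) with M nonempty, η constant
-- on coordinates in C, and η i m = i for m ∈ M.
IsCombLine : ∀ {k N} → PointMap k N → Set
IsCombLine {k} {N} η =
  Σ (Fin N → Bool) λ inM →
    (∃ λ m → inM m ≡ true)
    × (∀ c → inM c ≡ false → ∀ i j → η i c ≡ η j c)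
    × (∀ m → inM m ≡ true → ∀ i → η i m ≡ i)

_∈img_ : ∀ {k N} → Point k N → PointMap k N → Set
x ∈img η = ∃ λ i → η i ≈ₚ x

SameImage : ∀ {k N} → PointMap k N → PointMap k N → Set
SameImage η θ = (∀ i → η i ∈img θ) × (∀ j → θ j ∈img η)

-- A quasiline, given by an injective enumeration q : [k] → [k]^N of its
-- k elements, such that in every coordinate the entries are either all
-- identical or mutually distinct.
IsQuasiline : ∀ {k N} → PointMap k N → Set
IsQuasiline {k} {N} q =
  (∀ i j → q i ≈ₚ q j → i ≡ j)
  × (∀ c → (∀ i j → q i c ≡ q j c) ⊎ (∀ i j → q i c ≡ q j c → i ≡ j))

MutuallyDisjoint : ∀ {m k N} → (Fin m → PointMap k N) → Set
MutuallyDisjoint L = ∀ a b → a ≢ b → ∀ i j → ¬ (L a i ≈ₚ L b j)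

_∈⋃_ : ∀ {m k N} → Point k N → (Fin m → PointMap k N) → Set
x ∈⋃ L = ∃ λ a → x ∈img L a

{-# OPTIONS --safe #-}
-- Index the 2m coordinates by pairs (p, a) ∈ {0,1} × [m].  The line L_a
-- moves on the two coordinates of block a and is constant p on every
-- coordinate (p, b) with b ≠ a.  A point of L_a reads (i, i) on block a,
-- whereas every point of any other line reads (0, 1) there; since i cannot
-- be both 0 and 1 the lines are disjoint.  If a quasiline in ⋃ L had a point
-- on L_a and two further points off L_a, those two would agree on block a,
-- forcing both columns of block a to be constant, so the first point would
-- read (0, 1) there.  As k ≥ 3, every point of the quasiline therefore lies
-- on a single line L_a, and k distinct points of the k-element L_a exhaust it.
module Submission where

open import Defs
open import Data.Nat using (ℕ; suc; _+_; _*_; _≤_; s≤s)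
open import Data.Fin using (Fin; zero; suc; _↑ˡ_; remQuot; combine; punchOut)
open import Data.Fin.Properties
  using (_≟_; any?; remQuot-combine; injective⇒≤; punchOut-injective)
open import Data.Nat.Properties using (1+n≰n)
open import Data.Product using (Σ; ∃; _×_; _,_; proj₁; proj₂)
open import Data.Sum using (inj₁; inj₂)
open import Data.Bool using (Bool; true; false; if_then_else_)
open import Relation.Nullary using (¬_; yes; no; does; contradiction)
open import Relation.Nullary.Decidable using (dec-true; dec-false)
open import Data.Empty using (⊥; ⊥-elim)
open import Function using (_∘_; _$_)
open import Relation.Binary.PropositionalEquality
  using (_≡_; _≢_; refl; sym; trans; cong; subst; module ≡-Reasoning)

private
  variable
    k m n N : ℕ

Fin-injective⇒surjective : (f : Fin n → Fin n) → (∀ i j → f i ≡ f j → i ≡ j) →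
                           ∀ y → ∃ λ x → f x ≡ y
Fin-injective⇒surjective {suc n} f f-inj y with any? (λ x → f x ≟ y)
... | yes hit = hit
... | no miss = contradiction (injective⇒≤ avoid-y-injective) 1+n≰n
  where
  f≢y : ∀ x → y ≢ f x
  f≢y x y≡fx = miss (x , sym y≡fx)

  avoid-y-injective : ∀ {x x′} → punchOut (f≢y x) ≡ punchOut (f≢y x′) → x ≡ x′
  avoid-y-injective e = f-inj _ _ (punchOut-injective (f≢y _) (f≢y _) e)

sameImage-of-injective : {q η : PointMap k N} → (∀ i j → q i ≈ₚ q j → i ≡ j) →
                         (∀ i → q i ∈img η) → SameImage q η
sameImage-of-injective {k = k} {q = q} {η} q-inj q⊆η = q⊆η , η⊆q
  where
  index : Fin k → Fin k
  index i = proj₁ (q⊆η i)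

  index-injective : ∀ i j → index i ≡ index j → i ≡ j
  index-injective i j e = q-inj i j λ c →
    trans (sym (proj₂ (q⊆η i) c)) (trans (cong (λ x → η x c) e) (proj₂ (q⊆η j) c))

  η⊆q : ∀ j → η j ∈img q
  η⊆q j with Fin-injective⇒surjective index index-injective j
  ... | i , refl = i , λ c → sym (proj₂ (q⊆η i) c)

quasiline-column-constant : {q : PointMap k N} → IsQuasiline q → ∀ {j l c} →
                            j ≢ l → q j c ≡ q l c → ∀ i i′ → q i c ≡ q i′ c
quasiline-column-constant (_ , columns) {j} {l} {c} j≢l qj≡ql with columns c
... | inj₁ constant  = constant
... | inj₂ injective = contradiction (injective j l qj≡ql) j≢l

NoOutlier : {I : Set} → (I → Fin m) → Set
NoOutlier lab = ∀ i j l → j ≢ l → lab j ≢ lab i → lab l ≢ lab i → ⊥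

no-outlier⇒agree : {I : Set} {lab : I → Fin m} → NoOutlier lab →
                   ∀ {i j l} → i ≢ l → j ≢ l → lab i ≡ lab j
no-outlier⇒agree {lab = lab} no-outlier {i} {j} {l} i≢l j≢l with lab i ≟ lab j | lab l ≟ lab j
... | yes agree | _        = agree
... | no differ | yes l≡j  =
  ⊥-elim $ no-outlier i j l j≢l (differ ∘ sym) (λ l≡i → differ (trans (sym l≡i) l≡j))
... | no differ | no l≢j   = ⊥-elim $ no-outlier j i l i≢l differ l≢j

no-outlier⇒constant : {lab : Fin (3 + n) → Fin m} → NoOutlier lab → ∀ i → lab i ≡ lab zero
no-outlier⇒constant no-outlier zero          = refl
no-outlier⇒constant no-outlier (suc zero)    =
  no-outlier⇒agree no-outlier {l = suc (suc zero)} (λ ()) (λ ())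
no-outlier⇒constant no-outlier (suc (suc _)) =
  no-outlier⇒agree no-outlier {l = suc zero} (λ ()) (λ ())

module _ {m n : ℕ} where

  block : Fin (2 * m) → Fin m
  block c = proj₂ (remQuot {2} m c)

  side : Fin (2 * m) → Fin 2
  side c = proj₁ (remQuot {2} m c)

  coord : Fin 2 → Fin m → Fin (2 * m)
  coord = combine

  block-coord : ∀ p (a : Fin m) → block (coord p a) ≡ a
  block-coord p a = cong proj₂ (remQuot-combine p a)

  side-coord : ∀ p (a : Fin m) → side (coord p a) ≡ p
  side-coord p a = cong proj₁ (remQuot-combine p a)

  inBlock : Fin m → Fin (2 * m) → Bool
  inBlock a c = does (block c ≟ a)

  blockLine : Fin m → PointMap (2 + n) (2 * m)
  blockLine a i c = if inBlock a c then i else side c ↑ˡ n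

  blockLine-inside : ∀ (a : Fin m) i c → inBlock a c ≡ true → blockLine a i c ≡ i
  blockLine-inside a i c inside rewrite inside = refl

  blockLine-outside : ∀ (a : Fin m) i c → inBlock a c ≡ false →
                      blockLine a i c ≡ side c ↑ˡ n
  blockLine-outside a i c outside rewrite outside = refl

  blockLine-own-block : ∀ (a : Fin m) i p → blockLine a i (coord p a) ≡ i
  blockLine-own-block a i p = blockLine-inside a i (coord p a) (dec-true (_ ≟ a) (block-coord p a))

  blockLine-other-block : ∀ {a b : Fin m} → b ≢ a → ∀ i p → blockLine b i (coord p a) ≡ p ↑ˡ n
  blockLine-other-block {a = a} {b} b≢a i p =
    trans (blockLine-outside b i (coord p a) (dec-false (_ ≟ _) not-in-b))
          (cong (_↑ˡ n) (side-coord p a))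
    where
    not-in-b : block (coord p a) ≢ b
    not-in-b a≡b = b≢a (trans (sym a≡b) (block-coord p a))

  blockLine-isCombLine : ∀ (a : Fin m) → IsCombLine (blockLine a)
  blockLine-isCombLine a =
    inBlock a ,
    (coord zero a , dec-true (_ ≟ a) (block-coord zero a)) ,
    (λ c outside i j →
      trans (blockLine-outside a i c outside) (sym (blockLine-outside a j c outside))) ,
    (λ c inside i → blockLine-inside a i c inside)

  blockLine-not-01-on-own-block : ∀ (a : Fin m) i → ¬ (∀ p → blockLine a i (coord p a) ≡ p ↑ˡ n)
  blockLine-not-01-on-own-block a i reads-01 = 0≢1 (trans (sym (reads p0)) (reads p1))
    where
    reads : ∀ p → i ≡ p ↑ˡ n
    reads p = trans (sym (blockLine-own-block a i p)) (reads-01 p)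

    p0 p1 : Fin 2
    p0 = zero
    p1 = suc zero

    0≢1 : p0 ↑ˡ n ≢ p1 ↑ˡ n
    0≢1 ()

  blockLine-disjoint : MutuallyDisjoint blockLine
  blockLine-disjoint a b a≢b i j same = blockLine-not-01-on-own-block a i λ p →
    trans (same (coord p a)) (blockLine-other-block (a≢b ∘ sym) j p)

  quasiline-no-outlier-line : {q : PointMap (2 + n) (2 * m)} → IsQuasiline q →
    ∀ {i j l A B C} → q i ∈img blockLine A → q j ∈img blockLine B → q l ∈img blockLine C →
    j ≢ l → B ≢ A → C ≢ A → ⊥
  quasiline-no-outlier-line {q} quasi {i} {j} {l} {A} (t , qi) (u , qj) (v , ql) j≢l B≢A C≢A =
    blockLine-not-01-on-own-block A t λ p → begin
      blockLine A t (coord p A) ≡⟨ qi _ ⟩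
      q i (coord p A)           ≡⟨ quasiline-column-constant quasi j≢l (qj≡ql p) i j ⟩
      q j (coord p A)           ≡⟨ qj≡01 p ⟩
      p ↑ˡ n                    ∎
    where
    open ≡-Reasoning

    qj≡01 : ∀ p → q j (coord p A) ≡ p ↑ˡ n
    qj≡01 p = trans (sym (qj _)) (blockLine-other-block B≢A u p)

    qj≡ql : ∀ p → q j (coord p A) ≡ q l (coord p A)
    qj≡ql p = trans (qj≡01 p) (trans (sym (blockLine-other-block C≢A v p)) (ql _))

quasiline-in-blockLines : {q : PointMap (3 + n) (2 * m)} → IsQuasiline q →
                          (∀ i → q i ∈⋃ blockLine {m}) → ∃ λ a → SameImage q (blockLine a)
quasiline-in-blockLines {n = n} {m = m} {q = q} quasi q⊆⋃ =
  label zero , sameImage-of-injective (proj₁ quasi) q⊆line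
  where
  label : Fin (3 + n) → Fin m
  label i = proj₁ (q⊆⋃ i)

  no-outlier : NoOutlier label
  no-outlier i j l =
    quasiline-no-outlier-line quasi (proj₂ (q⊆⋃ i)) (proj₂ (q⊆⋃ j)) (proj₂ (q⊆⋃ l))

  q⊆line : ∀ i → q i ∈img blockLine (label zero)
  q⊆line i = subst (λ a → q i ∈img blockLine a) (no-outlier⇒constant no-outlier i) (proj₂ (q⊆⋃ i))

lemma4p2 : (k m : ℕ) → 3 ≤ k → 1 ≤ m →
    Σ (Fin m → PointMap k (2 * m)) λ L →
    (∀ a → IsCombLine (L a))
    × MutuallyDisjoint L
    × (∀ (q : PointMap k (2 * m)) → IsQuasiline q →
    (∀ i → q i ∈⋃ L) → ∃ λ a → SameImage q (L a))
lemma4p2 (suc (suc (suc n))) m (s≤s (s≤s (s≤s _))) _ =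
  blockLine {m} , blockLine-isCombLine , blockLine-disjoint , λ _ → quasiline-in-blockLines
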